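{- Let $r\ge 3$ and $n_1,\dots,n_r\ge 1$ be integers, and let $G$ be the spider graph $S_{n_1,\dots,n_r}$. Let $n=n_1+n_2+\cdots+n_r+1$ be its number of vertices and let $k$ be the number of indices $i$ for which $n_i$ is odd. Then $b_2(G)=\lceil n/2\rceil+1$ if $k\le 2$, and $b_2(G)=\frac{n+k-1}{2}$ if $k\ge 3$.
   Context: All graphs are finite and connected. The spider graph $S_{n_1,\dots,n_r}$ consists of a central vertex $v^*$ together with $r$ vertex-disjoint paths $P_{n_1},\dots,P_{n_r}$ (the path $P_{n_i}$ having $n_i$ vertices), where $v^*$ is joined by an edge to one endpoint of each path; so deleting $v^*$ leaves the paths $P_{n_1},\dots,P_{n_r}$. The 2-burning process: given a graph $G$ and a sequence $s=(s_1,\dots,s_m)$ of vertices of $G$ (called sources), at round $0$ all vertices are uncolored; at each round $j\ge1$, (i) if $j\le m$ and $s_j$ is uncolored, $s_j$ is colored blue, and (ii) every uncolored vertex having at least two neighbors that were blue at the end of round $j-1$ is colored blue. $s$ is a 2-burning sequence for $G$ if eventually all vertices are blue; then $\mathrm{len}(s)=m$ and $\mathrm{rd}(s)$ is the first round at the end of which all vertices are blue. The 2-burning number $b_2(G)$ is the minimum of $\mathrm{rd}(s)$ over all 2-burning sequences $s$ for $G$. -}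

module Defs where

open import Data.Nat using (ℕ; zero; suc; _+_; _*_; _∸_; _≤_; _%_)
open import Data.Fin using (Fin; toℕ)
open import Data.Vec using (Vec; lookup; sum; []; _∷_)
open import Data.List using (List; []; _∷_)
open import Data.Maybe using (Maybe; just; nothing)
open import Data.Product using (Σ; ∃; _×_; _,_)
open import Data.Sum using (_⊎_)
open import Data.Empty using (⊥)
open import Relation.Binary.PropositionalEquality using (_≡_)
open import Relation.Nullary using (¬_)

record Graph : Set₁ where
  field
    V   : Set
    Adj : V → V → Set
open Graph public

-- j-th element of a list, 1-indexed (source s_j); nothing if j = 0 or j > length.
source : {A : Set} → List A → ℕ → Maybe A
source []       _             = nothing
source (x ∷ xs) zero          = nothing
source (x ∷ xs) (suc zero)    = just x
source (x ∷ xs) (suc (suc j)) = source xs (suc j)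

-- Blue G s j v : vertex v is blue at the end of round j of the 2-burning
-- process of G with source sequence s.
Blue : (G : Graph) → List (V G) → ℕ → V G → Set
Blue G s zero    v = ⊥
Blue G s (suc j) v =
  Blue G s j v
  ⊎ (source s (suc j) ≡ just v)
  ⊎ (Σ (V G) λ u → Σ (V G) λ w →
       (¬ u ≡ w) × Adj G v u × Adj G v w × Blue G s j u × Blue G s j w)

AllBlue : (G : Graph) → List (V G) → ℕ → Set
AllBlue G s t = (v : V G) → Blue G s t v

IsB2 : Graph → ℕ → Set
IsB2 G b = (Σ (List (V G)) λ s → AllBlue G s b)
         × ((s : List (V G)) (t : ℕ) → AllBlue G s t → b ≤ t)

-- Spider S_{n_1,...,n_r}: centre, and leg i has vertices (i , j), j < n_i,
-- with (i , 0) adjacent to the centre.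
data SpiderV {r : ℕ} (ns : Vec ℕ r) : Set where
  centre : SpiderV ns
  leg    : (i : Fin r) → Fin (lookup ns i) → SpiderV ns

data SpiderAdj {r : ℕ} (ns : Vec ℕ r) : SpiderV ns → SpiderV ns → Set where
  c-l : ∀ {i j} → toℕ j ≡ 0 → SpiderAdj ns centre (leg i j)
  l-c : ∀ {i j} → toℕ j ≡ 0 → SpiderAdj ns (leg i j) centre
  up  : ∀ {i j j'} → suc (toℕ j) ≡ toℕ j' → SpiderAdj ns (leg i j) (leg i j')
  dn  : ∀ {i j j'} → toℕ j ≡ suc (toℕ j') → SpiderAdj ns (leg i j) (leg i j')

Spider : {r : ℕ} → Vec ℕ r → Graph
Spider ns = record { V = SpiderV ns ; Adj = SpiderAdj ns }

oddCount : {r : ℕ} → Vec ℕ r → ℕ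
oddCount []       = 0
oddCount (x ∷ xs) = x % 2 + oddCount xs

module Submission where

-- Fix a 2-burning sequence that has coloured the spider by round t and record the round at
-- which each vertex first turns blue.  A leg vertex has at most two neighbours, so unless it
-- is a source both of them turned blue before it: every leaf is a source, and of two
-- consecutive leg vertices at least one is.  A leg of m vertices therefore carries ⌈m/2⌉
-- sources, and one more if it is even and has a source next to the centre or two adjacent
-- sources, or if it has both.  As each round places at most one source, t ≥ C = Σᵢ ⌈nᵢ/2⌉.
-- If the centre is not a source, it was lit by two legs whose first vertices are sources.
-- Moreover, either no vertex is sourced in round t, and then all sources fit into t - 1
-- rounds, or every leg vertex adjacent to the vertex sourced in round t is a source too.
-- Playing these off against the parities of the legs gives t ≥ C + 1 if at most two legs are
-- odd and t ≥ C + 2 if none is.  Conversely, sourcing every other vertex of each leg, seeded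
-- by the centre, or by the first vertices of two odd legs when at least three legs are odd,
-- and then the leaves of the remaining odd legs burns the spider within these bounds.
-- Finally (n - 1) + k = 2C turns these bounds into the stated values.

open import Defs
open import Data.Bool using (Bool; true; false; if_then_else_)
import Data.Bool as Bool
open import Data.Bool.Properties using (¬-not; ∨-zeroʳ)
open import Data.Empty using (⊥-elim)
open import Data.Fin using (Fin; toℕ; fromℕ<; punchOut) renaming (zero to fzero; suc to fsuc)
import Data.Fin as Fin
open import Data.Fin.Properties using (punchIn-punchOut; punchOut-injective; toℕ-injective; toℕ-fromℕ<; toℕ<n)
import Data.Fin.Properties as Finₚ
open import Data.List using (List; []; _∷_; _++_; length; map; replicate)
open import Data.List.Membership.Propositional using (_∈_)
open import Data.List.Membership.Propositional.Properties using (∈-map⁺; ∈-++⁺ˡ; ∈-++⁺ʳ)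
open import Data.List.Properties using (length-map; length-++; length-++-≤ˡ; length-replicate; ++-identityʳ)
open import Data.List.Relation.Unary.Any using (here; there)
open import Data.Maybe using (Maybe; just; nothing)
import Data.Maybe.Properties as Maybe
open import Data.Nat
  using (ℕ; zero; suc; pred; _+_; _∸_; _≤_; _<_; ⌈_/2⌉; ⌊_/2⌋; z≤n; s≤s; s≤s⁻¹; _%_; NonZero; >-nonZero; ≢-nonZero)
open import Data.Nat.DivMod using (m%n<n)
open import Data.Nat.Properties
open import Data.Product using (Σ; ∃; _×_; _,_; proj₁; proj₂)
open import Data.Sum using (_⊎_; inj₁; inj₂)
import Data.Sum as Sum
open import Data.Vec using (Vec; lookup; sum; []; _∷_)
open import Data.Vec.Functional using (Vector; tail; removeAt)
import Data.Vec.Functional as Vector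
open import Algebra.Properties.CommutativeMonoid.Sum +-0-commutativeMonoid
  using (sum-syntax; sum-remove; ∑-distrib-+; sum-cong-≗; sum-replicate-zero) renaming (sum to ∑)
open import Algebra.Properties.CommutativeSemigroup +-commutativeSemigroup using (interchange)
open import Function using (_∘_; case_of_)
open import Function.Bundles using (mk⇔)
open import Relation.Binary.Definitions using (DecidableEquality)
open import Relation.Binary.PropositionalEquality
open import Relation.Nullary using (Dec; yes; no; contradiction)
open import Relation.Nullary.Decidable using (_⊎-dec_; _×-dec_; ¬?; does; does-⇔; dec-true; dec-false)

n%2≡0⊎n%2≡1 : ∀ n → n % 2 ≡ 0 ⊎ n % 2 ≡ 1
n%2≡0⊎n%2≡1 zero          = inj₁ refl
n%2≡0⊎n%2≡1 (suc zero)    = inj₂ refl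
n%2≡0⊎n%2≡1 (suc (suc n)) = n%2≡0⊎n%2≡1 n

⌈n/2⌉≡⌊n/2⌋+n%2 : ∀ n → ⌈ n /2⌉ ≡ ⌊ n /2⌋ + n % 2
⌈n/2⌉≡⌊n/2⌋+n%2 zero          = refl
⌈n/2⌉≡⌊n/2⌋+n%2 (suc zero)    = refl
⌈n/2⌉≡⌊n/2⌋+n%2 (suc (suc n)) = cong suc (⌈n/2⌉≡⌊n/2⌋+n%2 n)

⌈n/2⌉+⌈n/2⌉≡n+n%2 : ∀ n → ⌈ n /2⌉ + ⌈ n /2⌉ ≡ n + n % 2
⌈n/2⌉+⌈n/2⌉≡n+n%2 zero          = refl
⌈n/2⌉+⌈n/2⌉≡n+n%2 (suc zero)    = refl
⌈n/2⌉+⌈n/2⌉≡n+n%2 (suc (suc n)) = cong suc (trans (+-suc _ _) (cong suc (⌈n/2⌉+⌈n/2⌉≡n+n%2 n)))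

n%2≡0⇒⌊n/2⌋≡⌈n/2⌉ : ∀ {n} → n % 2 ≡ 0 → ⌊ n /2⌋ ≡ ⌈ n /2⌉
n%2≡0⇒⌊n/2⌋≡⌈n/2⌉ {n} even = sym (trans (⌈n/2⌉≡⌊n/2⌋+n%2 n) (trans (cong (⌊ n /2⌋ +_) even) (+-identityʳ _)))

even⇒2≤ : ∀ {m} → m % 2 ≡ 0 → 1 ≤ m → 2 ≤ m
even⇒2≤ {suc zero}    () _
even⇒2≤ {suc (suc m)} _  _ = s≤s (s≤s z≤n)

distinct⇒2≤ : ∀ {m} {j j′ : Fin m} → j ≢ j′ → 2 ≤ m
distinct⇒2≤ {suc zero}    {fzero} {fzero} j≢j′ = contradiction refl j≢j′
distinct⇒2≤ {suc (suc m)} _                    = s≤s (s≤s z≤n)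

odd⇒next-even : ∀ {a b} → suc a ≡ b → a % 2 ≡ 1 → b % 2 ≡ 0
odd⇒next-even {suc zero}    refl _   = refl
odd⇒next-even {suc (suc a)} refl odd = odd⇒next-even {a} refl odd

even⇒next-odd : ∀ {a b} → suc a ≡ b → a % 2 ≡ 0 → b % 2 ≡ 1
even⇒next-odd {zero}        refl _    = refl
even⇒next-odd {suc (suc a)} refl even = even⇒next-odd {a} refl even

next-even⇒odd : ∀ {a b} → suc a ≡ b → b % 2 ≡ 0 → a % 2 ≡ 1
next-even⇒odd {suc zero}    refl _    = refl
next-even⇒odd {suc (suc a)} refl even = next-even⇒odd {a} refl even

next-odd⇒even : ∀ {a b} → suc a ≡ b → b % 2 ≡ 1 → a % 2 ≡ 0
next-odd⇒even {zero}        refl _   = refl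
next-odd⇒even {suc (suc a)} refl odd = next-odd⇒even {a} refl odd

n%2≤1 : ∀ n → n % 2 ≤ 1
n%2≤1 n = s≤s⁻¹ (m%n<n n 2)

∑-mono-≤ : ∀ {n} {g h : Vector ℕ n} → (∀ i → g i ≤ h i) → ∑ g ≤ ∑ h
∑-mono-≤ {zero}  g≤h = z≤n
∑-mono-≤ {suc n} g≤h = +-mono-≤ (g≤h fzero) (∑-mono-≤ (g≤h ∘ fsuc))

∑-mono-< : ∀ {n} {g h : Vector ℕ n} (i : Fin n) → (∀ j → g j ≤ h j) → g i < h i → ∑ g < ∑ h
∑-mono-< fzero    g≤h gᵢ<hᵢ = +-mono-<-≤ gᵢ<hᵢ (∑-mono-≤ (g≤h ∘ fsuc))
∑-mono-< (fsuc i) g≤h gᵢ<hᵢ = +-mono-≤-< (g≤h fzero) (∑-mono-< i (g≤h ∘ fsuc) gᵢ<hᵢ)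

∑-mono-<₂ : ∀ {n} {g h : Vector ℕ n} {i j : Fin n} → i ≢ j → (∀ k → g k ≤ h k) →
            g i < h i → g j < h j → 2 + ∑ g ≤ ∑ h
∑-mono-<₂ {i = fzero}  {fzero}  i≢j _   _     _     = contradiction refl i≢j
∑-mono-<₂ {i = fzero}  {fsuc j} _   g≤h gᵢ<hᵢ gⱼ<hⱼ = +-mono-<₂ gᵢ<hᵢ (∑-mono-< j (g≤h ∘ fsuc) gⱼ<hⱼ)
  where
  +-mono-<₂ : ∀ {a b c d} → a < c → b < d → 2 + (a + b) ≤ c + d
  +-mono-<₂ {a} {b} a<c b<d = ≤-trans (≤-reflexive (cong suc (sym (+-suc a b)))) (+-mono-≤ a<c b<d)
∑-mono-<₂ {i = fsuc i} {fzero}  _   g≤h gᵢ<hᵢ gⱼ<hⱼ = ∑-mono-<₂ {i = fzero} {fsuc i} (λ ()) g≤h gⱼ<hⱼ gᵢ<hᵢ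
∑-mono-<₂ {g = g} {i = fsuc i} {fsuc j} i≢j g≤h gᵢ<hᵢ gⱼ<hⱼ =
  ≤-trans (≤-reflexive (sym (trans (+-suc (g fzero) _) (cong suc (+-suc (g fzero) _)))))
          (+-mono-≤ (g≤h fzero) (∑-mono-<₂ (i≢j ∘ cong fsuc) (g≤h ∘ fsuc) gᵢ<hᵢ gⱼ<hⱼ))

entry≤∑ : ∀ {n} (g : Vector ℕ n) i → g i ≤ ∑ g
entry≤∑ g fzero    = m≤m+n _ _
entry≤∑ g (fsuc i) = m≤n⇒m≤o+n (g fzero) (entry≤∑ (tail g) i)

removeAt-punchOut : ∀ {A : Set} {n} (g : Vector A (suc n)) {i j} (i≢j : i ≢ j) → removeAt g i (punchOut i≢j) ≡ g j
removeAt-punchOut g i≢j = cong g (punchIn-punchOut i≢j)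

entries₂≤∑ : ∀ {n} (g : Vector ℕ n) {i j} → i ≢ j → g i + g j ≤ ∑ g
entries₂≤∑ {suc n} g {i} i≢j = begin
  g i + g _                              ≡⟨ cong (g i +_) (removeAt-punchOut g i≢j) ⟨
  g i + removeAt g i (punchOut i≢j)      ≤⟨ +-monoʳ-≤ (g i) (entry≤∑ (removeAt g i) _) ⟩
  g i + ∑ (removeAt g i)                 ≡⟨ sum-remove g ⟨
  ∑ g                                    ∎
  where open ≤-Reasoning

entries₃≤∑ : ∀ {n} (g : Vector ℕ n) {i j k} → i ≢ j → i ≢ k → j ≢ k → g i + g j + g k ≤ ∑ g
entries₃≤∑ {suc n} g {i} {j} {k} i≢j i≢k j≢k = begin
  g i + g j + g k                                            ≡⟨ +-assoc (g i) _ _ ⟩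
  g i + (g j + g k)
    ≡⟨ cong₂ (λ x y → g i + (x + y)) (removeAt-punchOut g i≢j) (removeAt-punchOut g i≢k) ⟨
  g i + (removeAt g i (punchOut i≢j) + removeAt g i (punchOut i≢k))
    ≤⟨ +-monoʳ-≤ (g i) (entries₂≤∑ (removeAt g i) (j≢k ∘ punchOut-injective i≢j i≢k)) ⟩
  g i + ∑ (removeAt g i)                                     ≡⟨ sum-remove g ⟨
  ∑ g                                                        ∎
  where open ≤-Reasoning

positive-entry : ∀ {n} (g : Vector ℕ n) → 1 ≤ ∑ g → ∃ λ i → 1 ≤ g i
positive-entry {suc n} g 1≤∑ with g fzero in g₀
... | suc _ = fzero , ≤-trans (s≤s z≤n) (≤-reflexive (sym g₀))
... | zero  = let i , 1≤gᵢ = positive-entry (tail g) 1≤∑ in fsuc i , 1≤gᵢ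

two-positive-entries : ∀ {n} (g : Vector ℕ n) → (∀ i → g i ≤ 1) → 2 ≤ ∑ g →
                       Σ (Fin n) λ i → Σ (Fin n) λ j → i ≢ j × 1 ≤ g i × 1 ≤ g j
two-positive-entries {suc n} g g≤1 2≤∑ with g fzero in g₀
... | zero        = let i , j , i≢j , 1≤gᵢ , 1≤gⱼ = two-positive-entries (tail g) (g≤1 ∘ fsuc) 2≤∑
                    in fsuc i , fsuc j , i≢j ∘ Finₚ.suc-injective , 1≤gᵢ , 1≤gⱼ
... | suc zero    = let j , 1≤gⱼ = positive-entry (tail g) (s≤s⁻¹ 2≤∑)
                    in fzero , fsuc j , (λ ()) , ≤-reflexive (sym g₀) , 1≤gⱼ
... | suc (suc _) = contradiction (subst (_≤ 1) g₀ (g≤1 fzero)) λ { (s≤s ()) }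

𝟙 : Bool → ℕ
𝟙 true  = 1
𝟙 false = 0

∑-0 : ∀ {n} (g : Vector ℕ n) → (∀ i → g i ≡ 0) → ∑ g ≡ 0
∑-0 {n} _ g≡0 = trans (sum-cong-≗ g≡0) (sum-replicate-zero n)

∑-𝟙-≟ : ∀ {n} (i : Fin n) → ∑[ j < n ] 𝟙 (does (i Fin.≟ j)) ≡ 1
∑-𝟙-≟ {suc n} fzero = cong suc (sum-replicate-zero n)
∑-𝟙-≟ (fsuc i)      = ∑-𝟙-≟ i

sum≡∑lookup : ∀ {m} (v : Vec ℕ m) → sum v ≡ ∑[ i < m ] lookup v i
sum≡∑lookup []      = refl
sum≡∑lookup (x ∷ v) = cong (x +_) (sum≡∑lookup v)

oddCount≡∑ : ∀ {m} (v : Vec ℕ m) → oddCount v ≡ ∑[ i < m ] (lookup v i % 2)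
oddCount≡∑ []      = refl
oddCount≡∑ (x ∷ v) = cong (x % 2 +_) (oddCount≡∑ v)

-- σ j counts the sources at position j of a path whose position n - 1 is a leaf: the leaf is
-- hit, and no two consecutive positions are both missed.
record Covered {n} (σ : Vector ℕ n) : Set where
  field
    pair : ∀ {j j′ : Fin n} → suc (toℕ j) ≡ toℕ j′ → 1 ≤ σ j ⊎ 1 ≤ σ j′
    end  : ∀ {j : Fin n} → suc (toℕ j) ≡ n → 1 ≤ σ j

open Covered

covered-tail : ∀ {n} {σ : Vector ℕ (suc n)} → Covered σ → Covered (tail σ)
covered-tail cov = record { pair = λ e → pair cov (cong suc e) ; end = λ e → end cov (cong suc e) }

first-pair-hit : ∀ {n} {σ : Vector ℕ (suc (suc n))} → Covered σ → 1 ≤ σ fzero + σ (fsuc fzero)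
first-pair-hit {σ = σ} cov with pair cov {fzero} {fsuc fzero} refl
... | inj₁ h = ≤-trans h (m≤m+n _ _)
... | inj₂ h = ≤-trans h (m≤n+m _ _)

skip-first-pair : ∀ {n} {σ : Vector ℕ (suc (suc n))} {k} → Covered σ →
                  k ≤ ∑ (tail (tail σ)) → suc k ≤ ∑ σ
skip-first-pair {σ = σ} cov k≤ =
  ≤-trans (+-mono-≤ (first-pair-hit cov) k≤) (≤-reflexive (+-assoc (σ fzero) _ _))

⌈n/2⌉≤∑ : ∀ {n} {σ : Vector ℕ n} → Covered σ → ⌈ n /2⌉ ≤ ∑ σ
⌈n/2⌉≤∑ {zero}        cov = z≤n
⌈n/2⌉≤∑ {suc zero}    cov = ≤-trans (end cov {fzero} refl) (m≤m+n _ _)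
⌈n/2⌉≤∑ {suc (suc n)} cov = skip-first-pair cov (⌈n/2⌉≤∑ (covered-tail (covered-tail cov)))

head⇒1+⌊n/2⌋≤∑ : ∀ {n} {σ : Vector ℕ n} {j} → Covered σ → toℕ j ≡ 0 → 1 ≤ σ j → suc ⌊ n /2⌋ ≤ ∑ σ
head⇒1+⌊n/2⌋≤∑ {j = fzero} cov _ h = +-mono-≤ h (⌈n/2⌉≤∑ (covered-tail cov))

pair⇒1+⌊n/2⌋≤∑ : ∀ {n} {σ : Vector ℕ n} {j j′} → Covered σ → suc (toℕ j) ≡ toℕ j′ →
                  1 ≤ σ j → 1 ≤ σ j′ → suc ⌊ n /2⌋ ≤ ∑ σ
pair⇒1+⌊n/2⌋≤∑ {j = fzero} {fsuc fzero} cov _ h h′ =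
  +-mono-≤ h (+-mono-≤ h′ (≤-trans (⌊n/2⌋≤⌈n/2⌉ _) (⌈n/2⌉≤∑ (covered-tail (covered-tail cov)))))
pair⇒1+⌊n/2⌋≤∑ {σ = σ} {j = fsuc fzero} {fsuc (fsuc fzero)} cov _ h h′ =
  m≤n⇒m≤o+n (σ fzero) (+-mono-≤ h (+-mono-≤ h′ (⌈n/2⌉≤∑ (covered-tail (covered-tail (covered-tail cov))))))
pair⇒1+⌊n/2⌋≤∑ {j = fsuc (fsuc k)} {fsuc (fsuc k′)} cov e h h′ =
  skip-first-pair cov (pair⇒1+⌊n/2⌋≤∑ (covered-tail (covered-tail cov)) (suc-injective (suc-injective e)) h h′)

head-pair⇒1+⌈n/2⌉≤∑ : ∀ {n} {σ : Vector ℕ n} {j₀ j j′} → Covered σ → toℕ j₀ ≡ 0 → 1 ≤ σ j₀ →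
                       suc (toℕ j) ≡ toℕ j′ → 1 ≤ σ j → 1 ≤ σ j′ → suc ⌈ n /2⌉ ≤ ∑ σ
head-pair⇒1+⌈n/2⌉≤∑ {j₀ = fzero} {fzero} {fsuc fzero} cov _ _ _ h h′ =
  +-mono-≤ h (+-mono-≤ h′ (⌈n/2⌉≤∑ (covered-tail (covered-tail cov))))
head-pair⇒1+⌈n/2⌉≤∑ {j₀ = fzero} {fsuc k} {fsuc k′} cov _ h₀ e h h′ =
  +-mono-≤ h₀ (pair⇒1+⌊n/2⌋≤∑ (covered-tail cov) (suc-injective e) h h′)

oddPositions : ∀ m → List (Fin m)
oddPositions zero          = []
oddPositions (suc zero)    = []
oddPositions (suc (suc m)) = fsuc fzero ∷ map (fsuc ∘ fsuc) (oddPositions m)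

positiveEvenPositions : ∀ m → List (Fin m)
positiveEvenPositions zero    = []
positiveEvenPositions (suc m) = map fsuc (oddPositions m)

length-oddPositions : ∀ m → length (oddPositions m) ≤ ⌊ m /2⌋
length-oddPositions zero          = z≤n
length-oddPositions (suc zero)    = z≤n
length-oddPositions (suc (suc m)) = s≤s (≤-trans (≤-reflexive (length-map _ (oddPositions m))) (length-oddPositions m))

length-positiveEvenPositions : ∀ m → length (positiveEvenPositions m) ≤ ⌊ m /2⌋
length-positiveEvenPositions zero    = z≤n
length-positiveEvenPositions (suc m) =
  ≤-trans (≤-reflexive (length-map fsuc (oddPositions m))) (≤-trans (length-oddPositions m) (⌊n/2⌋-mono (n≤1+n m)))

∈-oddPositions : ∀ {m} (j : Fin m) → toℕ j % 2 ≡ 1 → j ∈ oddPositions m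
∈-oddPositions {suc (suc m)} (fsuc fzero)    _   = here refl
∈-oddPositions {suc (suc m)} (fsuc (fsuc j)) odd = there (∈-map⁺ (fsuc ∘ fsuc) (∈-oddPositions j odd))

∈-positiveEvenPositions : ∀ {m} (j : Fin m) → toℕ j % 2 ≡ 0 → toℕ j ≢ 0 → j ∈ positiveEvenPositions m
∈-positiveEvenPositions fzero    _    j≢0 = contradiction refl j≢0
∈-positiveEvenPositions (fsuc j) even _   = ∈-map⁺ fsuc (∈-oddPositions j (next-even⇒odd {toℕ j} refl even))

concatᵛ : ∀ {A : Set} {m} → Vector (List A) m → List A
concatᵛ = Vector.foldr _++_ []

length-concatᵛ : ∀ {A : Set} {m} (xss : Vector (List A) m) → length (concatᵛ xss) ≡ ∑[ i < m ] length (xss i)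
length-concatᵛ {m = zero}  xss = refl
length-concatᵛ {m = suc m} xss = trans (length-++ (xss fzero)) (cong (length (xss fzero) +_) (length-concatᵛ (tail xss)))

∈-concatᵛ : ∀ {A : Set} {m} {x : A} (xss : Vector (List A) m) i → x ∈ xss i → x ∈ concatᵛ xss
∈-concatᵛ xss fzero    x∈ = ∈-++⁺ˡ x∈
∈-concatᵛ xss (fsuc i) x∈ = ∈-++⁺ʳ (xss fzero) (∈-concatᵛ (tail xss) i x∈)

module Burning (G : Graph) where

  blue-mono : ∀ {s j k v} → j ≤ k → Blue G s j v → Blue G s k v
  blue-mono {j = suc j} {suc k} j≤k b with m≤n⇒m<n∨m≡n j≤k
  ... | inj₁ j<k  = inj₁ (blue-mono (s≤s⁻¹ j<k) b)
  ... | inj₂ refl = b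

  spread : ∀ {s j u w v} → u ≢ w → Adj G v u → Adj G v w →
           Blue G s j u → Blue G s j w → Blue G s (suc j) v
  spread u≢w vu vw bu bw = inj₂ (inj₂ (_ , _ , u≢w , vu , vw , bu , bw))

  source-++ : ∀ (xs ys : List (V G)) {v} → v ∈ xs →
              Σ ℕ λ p → p < length xs × source (xs ++ ys) (suc p) ≡ just v
  source-++ (x ∷ xs) ys (here refl) = 0 , s≤s z≤n , refl
  source-++ (x ∷ xs) ys (there v∈xs) with source-++ xs ys v∈xs
  ... | p , p<n , e = suc p , s≤s p<n , e

  prefix-blue : ∀ (xs ys : List (V G)) {v j} → v ∈ xs → length xs ≤ j → Blue G (xs ++ ys) j v
  prefix-blue xs ys v∈xs n≤j =
    let p , p<n , e = source-++ xs ys v∈xs in blue-mono (≤-trans p<n n≤j) (inj₂ (inj₁ e))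

  module Decided (_≟ᵥ_ : DecidableEquality (V G)) (adj? : ∀ u v → Dec (Adj G u v))
                 (any? : ∀ {P : V G → Set} → (∀ v → Dec (P v)) → Dec (∃ P)) where

    blue? : ∀ s j v → Dec (Blue G s j v)
    blue? s zero    v = no λ ()
    blue? s (suc j) v =
      blue? s j v ⊎-dec Maybe.≡-dec _≟ᵥ_ (source s (suc j)) (just v) ⊎-dec
      any? λ u → any? λ w → ¬? (u ≟ᵥ w) ×-dec adj? v u ×-dec adj? v w ×-dec blue? s j u ×-dec blue? s j w

    first-blue-round : ∀ {s t v} → Blue G s t v → Σ ℕ λ m → Blue G s m v × ∀ k → Blue G s k v → m ≤ k
    first-blue-round {s} {suc t} {v} b with blue? s t v
    ... | yes b′ = first-blue-round b′
    ... | no ¬b  = suc t , b , λ k bₖ → ≮⇒≥ λ k<1+t → ¬b (blue-mono (s≤s⁻¹ k<1+t) bₖ)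

    module Process (s : List (V G)) (t : ℕ) (all-blue : AllBlue G s t) where

      firstBlue : V G → ℕ
      firstBlue v = proj₁ (first-blue-round (all-blue v))

      blue-at-firstBlue : ∀ v → Blue G s (firstBlue v) v
      blue-at-firstBlue v = proj₁ (proj₂ (first-blue-round (all-blue v)))

      firstBlue-least : ∀ v k → Blue G s k v → firstBlue v ≤ k
      firstBlue-least v = proj₂ (proj₂ (first-blue-round (all-blue v)))

      firstBlue≤t : ∀ v → firstBlue v ≤ t
      firstBlue≤t v = firstBlue-least v t (all-blue v)

      1≤firstBlue : ∀ v → 1 ≤ firstBlue v
      1≤firstBlue v with firstBlue v | blue-at-firstBlue v
      ... | suc _ | _ = s≤s z≤n

      Sourced : V G → Set
      Sourced v = source s (firstBlue v) ≡ just v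

      Propagated : V G → Set
      Propagated v = Σ (V G) λ u → Σ (V G) λ w → u ≢ w × Adj G v u × Adj G v w ×
                     firstBlue u < firstBlue v × firstBlue w < firstBlue v

      sourced-or-propagated : ∀ v → Sourced v ⊎ Propagated v
      sourced-or-propagated v = classify (firstBlue v) (blue-at-firstBlue v) (firstBlue-least v)
        where
        classify : ∀ m → Blue G s m v → (∀ k → Blue G s k v → m ≤ k) →
                   source s m ≡ just v ⊎ Σ (V G) λ u → Σ (V G) λ w → u ≢ w × Adj G v u × Adj G v w ×
                                                       firstBlue u < m × firstBlue w < m
        classify (suc j) (inj₁ b)        least = ⊥-elim (1+n≰n (least j b))
        classify (suc j) (inj₂ (inj₁ e)) least = inj₁ e
        classify (suc j) (inj₂ (inj₂ (u , w , u≢w , vu , vw , bu , bw))) least =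
          inj₂ (u , w , u≢w , vu , vw , s≤s (firstBlue-least u j bu) , s≤s (firstBlue-least w j bw))

      SourcedInLastRound : Set
      SourcedInLastRound = Σ (V G) λ x → Sourced x × firstBlue x ≡ t

      NoSourceInLastRound : Set
      NoSourceInLastRound = ∀ v → Sourced v → firstBlue v < t

      last-round : SourcedInLastRound ⊎ NoSourceInLastRound
      last-round with source s t in sₜ
      ... | nothing = inj₂ λ v src → ≤∧≢⇒< (firstBlue≤t v) λ e →
                        case trans (sym sₜ) (subst (λ m → source s m ≡ just v) e src) of λ ()
      ... | just x with firstBlue x ≟ t
      ...   | yes e  = inj₁ (x , trans (cong (source s) e) sₜ , e)
      ...   | no x≢t = inj₂ λ v src → ≤∧≢⇒< (firstBlue≤t v) λ e →
                         x≢t (trans (cong firstBlue (Maybe.just-injective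
                               (trans (sym sₜ) (subst (λ m → source s m ≡ just v) e src)))) e)

module SpiderGraph {r : ℕ} (ns : Vec ℕ r) where

  n : Fin r → ℕ
  n i = lookup ns i

  _≟ᵥ_ : DecidableEquality (SpiderV ns)
  centre  ≟ᵥ centre   = yes refl
  centre  ≟ᵥ leg _ _  = no λ ()
  leg _ _ ≟ᵥ centre   = no λ ()
  leg i j ≟ᵥ leg i′ j′ with i Fin.≟ i′
  ... | no i≢i′ = no λ { refl → i≢i′ refl }
  ... | yes refl with j Fin.≟ j′
  ...   | yes refl = yes refl
  ...   | no j≢j′  = no λ { refl → j≢j′ refl }

  adj? : ∀ u v → Dec (SpiderAdj ns u v)
  adj? centre    centre    = no λ ()
  adj? centre    (leg i j) with toℕ j ≟ 0
  ... | yes e = yes (c-l e)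
  ... | no ¬e = no λ { (c-l e) → ¬e e }
  adj? (leg i j) centre    with toℕ j ≟ 0
  ... | yes e = yes (l-c e)
  ... | no ¬e = no λ { (l-c e) → ¬e e }
  adj? (leg i j) (leg i′ j′) with i Fin.≟ i′
  ... | no i≢i′ = no λ { (up _) → i≢i′ refl ; (dn _) → i≢i′ refl }
  ... | yes refl with suc (toℕ j) ≟ toℕ j′ | toℕ j ≟ suc (toℕ j′)
  ...   | yes e | _     = yes (up e)
  ...   | no _  | yes e = yes (dn e)
  ...   | no ¬u | no ¬d = no λ { (up e) → ¬u e ; (dn e) → ¬d e }

  anyᵥ? : ∀ {P : SpiderV ns → Set} → (∀ v → Dec (P v)) → Dec (∃ P)
  anyᵥ? P? with P? centre | Finₚ.any? (λ i → Finₚ.any? λ j → P? (leg i j))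
  ... | yes p | _                 = yes (centre , p)
  ... | no _  | yes (i , j , p)   = yes (leg i j , p)
  ... | no ¬p | no ¬q             = no λ { (centre , p) → ¬p p ; (leg i j , p) → ¬q (i , j , p) }

  outward : ∀ {i j y} → SpiderAdj ns (leg i j) y → Bool
  outward (l-c _) = false
  outward (up _)  = true
  outward (dn _)  = false

  same-side⇒≡ : ∀ {i j y z} (p : SpiderAdj ns (leg i j) y) (q : SpiderAdj ns (leg i j) z) →
                outward p ≡ outward q → y ≡ z
  same-side⇒≡ (l-c _) (l-c _) _ = refl
  same-side⇒≡ (l-c e) (dn e′) _ = contradiction (trans (sym e) e′) 0≢1+n
  same-side⇒≡ (dn e′) (l-c e) _ = contradiction (trans (sym e) e′) 0≢1+n
  same-side⇒≡ (up e)  (up e′) _ = cong (leg _) (toℕ-injective (trans (sym e) e′))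
  same-side⇒≡ (dn e)  (dn e′) _ = cong (leg _) (toℕ-injective (suc-injective (trans (sym e) e′)))

  leg-neighbours : ∀ {i j u w y} → SpiderAdj ns (leg i j) u → SpiderAdj ns (leg i j) w → u ≢ w →
                   SpiderAdj ns (leg i j) y → y ≡ u ⊎ y ≡ w
  leg-neighbours pu pw u≢w py with outward py Bool.≟ outward pu | outward py Bool.≟ outward pw
  ... | yes e | _     = inj₁ (same-side⇒≡ py pu e)
  ... | no _  | yes e = inj₂ (same-side⇒≡ py pw e)
  ... | no ≢u | no ≢w =
    contradiction (same-side⇒≡ pu pw (trans (¬-not (≢u ∘ sym)) (sym (¬-not (≢w ∘ sym))))) u≢w

  end-inward : ∀ {i j y} → suc (toℕ j) ≡ n i → (p : SpiderAdj ns (leg i j) y) → outward p ≡ false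
  end-inward e (l-c _)                = refl
  end-inward e (up {j' = k} e′)       = contradiction (trans (sym e′) e) (<⇒≢ (toℕ<n k))
  end-inward e (dn _)                 = refl

  below : ∀ {i} {j : Fin (n i)} → toℕ j ≢ 0 → Σ (Fin (n i)) λ k → suc (toℕ k) ≡ toℕ j
  below {i} {j} j≢0 = fromℕ< p , trans (cong suc (toℕ-fromℕ< p)) (suc-pred (toℕ j) {{≢-nonZero j≢0}})
    where
    p : pred (toℕ j) < n i
    p = ≤-trans (≤-reflexive (suc-pred (toℕ j) {{≢-nonZero j≢0}})) (<⇒≤ (toℕ<n j))

  above : ∀ {i} {j : Fin (n i)} → suc (toℕ j) ≢ n i → Σ (Fin (n i)) λ k → suc (toℕ j) ≡ toℕ k
  above {i} {j} ≢n = fromℕ< q , sym (toℕ-fromℕ< q)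
    where
    q : suc (toℕ j) < n i
    q = ≤∧≢⇒< (toℕ<n j) ≢n

  C : ℕ
  C = ∑[ i < r ] ⌈ n i /2⌉

  K : ℕ
  K = ∑[ i < r ] (n i % 2)

  ∑ᵥ : (SpiderV ns → ℕ) → ℕ
  ∑ᵥ g = g centre + ∑[ i < r ] ∑[ j < n i ] g (leg i j)

  ∑ᵥ-+ : ∀ g h → ∑ᵥ (λ v → g v + h v) ≡ ∑ᵥ g + ∑ᵥ h
  ∑ᵥ-+ g h = trans (cong (g centre + h centre +_) on-legs) (interchange (g centre) (h centre) _ _)
    where
    on-legs : ∑[ i < r ] ∑[ j < n i ] (g (leg i j) + h (leg i j))
            ≡ ∑[ i < r ] ∑[ j < n i ] g (leg i j) + ∑[ i < r ] ∑[ j < n i ] h (leg i j)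
    on-legs = trans (sum-cong-≗ λ i → ∑-distrib-+ (λ j → g (leg i j)) (λ j → h (leg i j)))
                    (∑-distrib-+ (λ i → ∑[ j < n i ] g (leg i j)) (λ i → ∑[ j < n i ] h (leg i j)))

  ∑ᵥ-𝟙-≟ : ∀ u → ∑ᵥ (λ v → 𝟙 (does (u ≟ᵥ v))) ≡ 1
  ∑ᵥ-𝟙-≟ centre     = cong suc (∑-0 _ λ i → ∑-0 (λ j → 𝟙 (does (centre ≟ᵥ leg i j))) λ _ → refl)
  ∑ᵥ-𝟙-≟ (leg i′ j′) = trans (sum-cong-≗ on-leg) (∑-𝟙-≟ i′)
    where
    on-leg : ∀ i → ∑[ j < n i ] 𝟙 (does (leg i′ j′ ≟ᵥ leg i j)) ≡ 𝟙 (does (i′ Fin.≟ i))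
    on-leg i = case i′ Fin.≟ i of λ
      { (yes refl) → trans (sum-cong-≗ λ j → cong 𝟙 (does-⇔ (mk⇔ (λ { refl → refl }) (cong (leg i′)))
                                                           (leg i′ j′ ≟ᵥ leg i′ j) (j′ Fin.≟ j)))
                           (trans (∑-𝟙-≟ j′) (cong 𝟙 (sym (dec-true (i′ Fin.≟ i′) refl))))
      ; (no i′≢i)  → trans (∑-0 _ λ j → cong 𝟙 (dec-false (leg i′ j′ ≟ᵥ leg i j) λ { refl → i′≢i refl }))
                           (cong 𝟙 (sym (dec-false (i′ Fin.≟ i) i′≢i)))
      }

  ∑ᵥ-0 : ∑ᵥ (λ _ → 0) ≡ 0
  ∑ᵥ-0 = ∑-0 _ λ i → sum-replicate-zero (n i)

  hit : Maybe (SpiderV ns) → SpiderV ns → ℕ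
  hit nothing  v = 0
  hit (just u) v = 𝟙 (does (u ≟ᵥ v))

  placements : List (SpiderV ns) → ℕ → SpiderV ns → ℕ
  placements s zero    v = 0
  placements s (suc T) v = placements s T v + hit (source s (suc T)) v

  ∑ᵥ-hit : ∀ m → ∑ᵥ (hit m) ≤ 1
  ∑ᵥ-hit nothing  = ≤-trans (≤-reflexive ∑ᵥ-0) z≤n
  ∑ᵥ-hit (just u) = ≤-reflexive (∑ᵥ-𝟙-≟ u)

  ∑ᵥ-placements : ∀ s T → ∑ᵥ (placements s T) ≤ T
  ∑ᵥ-placements s zero    = ≤-reflexive ∑ᵥ-0
  ∑ᵥ-placements s (suc T) = begin
    ∑ᵥ (placements s (suc T))                            ≡⟨ ∑ᵥ-+ (placements s T) (hit (source s (suc T))) ⟩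
    ∑ᵥ (placements s T) + ∑ᵥ (hit (source s (suc T)))
      ≤⟨ +-mono-≤ (∑ᵥ-placements s T) (∑ᵥ-hit (source s (suc T))) ⟩
    T + 1                                                ≡⟨ +-comm T 1 ⟩
    suc T                                                ∎
    where open ≤-Reasoning

  placements-source : ∀ s {T j v} → source s j ≡ just v → 1 ≤ j → j ≤ T → 1 ≤ placements s T v
  placements-source s {zero}  sⱼ≡v 1≤j j≤0 = contradiction (≤-trans 1≤j j≤0) λ ()
  placements-source s {suc T} {j} {v} sⱼ≡v 1≤j j≤1+T with m≤n⇒m<n∨m≡n j≤1+T
  ... | inj₁ j<1+T = m≤n⇒m≤n+o _ (placements-source s sⱼ≡v 1≤j (s≤s⁻¹ j<1+T))
  ... | inj₂ refl  = m≤n⇒m≤o+n _ (≤-reflexive (sym hit≡1))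
    where
    hit≡1 : hit (source s j) v ≡ 1
    hit≡1 = trans (cong (λ m → hit m v) sⱼ≡v) (cong 𝟙 (dec-true (v ≟ᵥ v) refl))

module LowerBound {r : ℕ} (ns : Vec ℕ r) (legs-nonempty : ∀ i → 1 ≤ lookup ns i)
                  (s : List (SpiderV ns)) (t : ℕ) (all-blue : AllBlue (Spider ns) s t) where
  open SpiderGraph ns
  open Burning (Spider ns)
  open Decided _≟ᵥ_ adj? anyᵥ?
  open Process s t all-blue

  sourced-if-no-later : ∀ {i j x} → SpiderAdj ns (leg i j) x → firstBlue (leg i j) ≤ firstBlue x →
                        Sourced (leg i j)
  sourced-if-no-later ix ≤x with sourced-or-propagated (leg _ _)
  ... | inj₁ src = src
  ... | inj₂ (u , w , u≢w , iu , iw , u< , w<) with leg-neighbours iu iw u≢w ix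
  ...   | inj₁ refl = contradiction ≤x (<⇒≱ u<)
  ...   | inj₂ refl = contradiction ≤x (<⇒≱ w<)

  end-sourced : ∀ {i j} → suc (toℕ j) ≡ n i → Sourced (leg i j)
  end-sourced e with sourced-or-propagated (leg _ _)
  ... | inj₁ src = src
  ... | inj₂ (u , w , u≢w , iu , iw , _) =
    contradiction (same-side⇒≡ iu iw (trans (end-inward e iu) (sym (end-inward e iw)))) u≢w

  adjacent-sourced : ∀ {i j j′} → suc (toℕ j) ≡ toℕ j′ → Sourced (leg i j) ⊎ Sourced (leg i j′)
  adjacent-sourced {i} {j} {j′} e with ≤-total (firstBlue (leg i j)) (firstBlue (leg i j′))
  ... | inj₁ ≤j′ = inj₁ (sourced-if-no-later (up e) ≤j′)
  ... | inj₂ ≤j  = inj₂ (sourced-if-no-later (dn (sym e)) ≤j)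

  SourcedHead : Fin r → Set
  SourcedHead i = Σ (Fin (n i)) λ j → toℕ j ≡ 0 × Sourced (leg i j)

  SourcedPair : Fin r → Set
  SourcedPair i = Σ (Fin (n i)) λ j → Σ (Fin (n i)) λ j′ →
                  suc (toℕ j) ≡ toℕ j′ × Sourced (leg i j) × Sourced (leg i j′)

  record Feeder (i : Fin r) : Set where
    field
      position : Fin (n i)
      first    : toℕ position ≡ 0
      earlier  : firstBlue (leg i position) < firstBlue centre

  feeder-head : ∀ {i} → Feeder i → SourcedHead i
  feeder-head f = position , first , sourced-if-no-later (l-c first) (<⇒≤ earlier)
    where open Feeder f

  centre-feeders : Propagated centre → Σ (Fin r) λ a → Σ (Fin r) λ b → a ≢ b × Feeder a × Feeder b
  centre-feeders (_ , _ , u≢w , c-l {i = a} {j = ja} ea , c-l {i = b} {j = jb} eb , a< , b<) =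
    a , b , a≢b , record { position = ja ; first = ea ; earlier = a< }
                , record { position = jb ; first = eb ; earlier = b< }
    where
    a≢b : a ≢ b
    a≢b refl = u≢w (cong (leg a) (toℕ-injective (trans ea (sym eb))))

  sourced-next-to-last : ∀ {i j x} → firstBlue x ≡ t → SpiderAdj ns (leg i j) x → Sourced (leg i j)
  sourced-next-to-last e ix = sourced-if-no-later ix (≤-trans (firstBlue≤t _) (≤-reflexive (sym e)))

  head-at-last-round : firstBlue centre ≡ t → ∀ i → SourcedHead i
  head-at-last-round e i =
    fromℕ< (legs-nonempty i) , toℕ-fromℕ< _ , sourced-next-to-last e (l-c (toℕ-fromℕ< _))

  pair-at-last-round : ∀ {c j} → Sourced (leg c j) → firstBlue (leg c j) ≡ t → 2 ≤ n c → SourcedPair c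
  pair-at-last-round {c} {j} src e 2≤n with toℕ j ≟ 0
  ... | yes j≡0 = let k′ , j↑k′ = above (<⇒≢ 2≤n ∘ trans (cong suc (sym j≡0)))
                  in j , k′ , j↑k′ , src , sourced-next-to-last e (dn (sym j↑k′))
  ... | no  j≢0 = let k , k↑j = below j≢0
                  in k , j , k↑j , sourced-next-to-last e (up k↑j) , src

  -- Sources are counted over the rounds 1, …, T, where T is t, or t - 1 if round t places none.
  module Horizon (T : ℕ) (horizon : ∀ v → Sourced v → firstBlue v ≤ T) where

    placed : SpiderV ns → ℕ
    placed = placements s T

    sourced⇒placed : ∀ {v} → Sourced v → 1 ≤ placed v
    sourced⇒placed src = placements-source s src (1≤firstBlue _) (horizon _ src)

    legPlaced : (i : Fin r) → Vector ℕ (n i)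
    legPlaced i j = placed (leg i j)

    legPlaced-covered : ∀ i → Covered (legPlaced i)
    legPlaced-covered i = record
      { pair = λ e → Sum.map sourced⇒placed sourced⇒placed (adjacent-sourced e)
      ; end  = λ e → sourced⇒placed (end-sourced e)
      }

    Surplus : Fin r → Set
    Surplus i = suc ⌈ n i /2⌉ ≤ ∑ (legPlaced i)

    head-surplus : ∀ {i} → n i % 2 ≡ 0 → SourcedHead i → Surplus i
    head-surplus {i} even (j , j≡0 , src) =
      subst (λ m → suc m ≤ ∑ (legPlaced i)) (n%2≡0⇒⌊n/2⌋≡⌈n/2⌉ even)
            (head⇒1+⌊n/2⌋≤∑ (legPlaced-covered i) j≡0 (sourced⇒placed src))

    pair-surplus : ∀ {i} → n i % 2 ≡ 0 → SourcedPair i → Surplus i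
    pair-surplus {i} even (j , j′ , e , src , src′) =
      subst (λ m → suc m ≤ ∑ (legPlaced i)) (n%2≡0⇒⌊n/2⌋≡⌈n/2⌉ even)
            (pair⇒1+⌊n/2⌋≤∑ (legPlaced-covered i) e (sourced⇒placed src) (sourced⇒placed src′))

    head-pair-surplus : ∀ {i} → SourcedHead i → SourcedPair i → Surplus i
    head-pair-surplus {i} (j₀ , j₀≡0 , src₀) (j , j′ , e , src , src′) =
      head-pair⇒1+⌈n/2⌉≤∑ (legPlaced-covered i) j₀≡0 (sourced⇒placed src₀)
                                                 e (sourced⇒placed src) (sourced⇒placed src′)

    legPlacements : ℕ
    legPlacements = ∑[ i < r ] ∑ (legPlaced i)

    ⌈n/2⌉≤legPlaced : ∀ i → ⌈ n i /2⌉ ≤ ∑ (legPlaced i)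
    ⌈n/2⌉≤legPlaced i = ⌈n/2⌉≤∑ (legPlaced-covered i)

    placed-total : placed centre + legPlacements ≤ T
    placed-total = ∑ᵥ-placements s T

    legPlacements≤T : legPlacements ≤ T
    legPlacements≤T = ≤-trans (m≤n+m legPlacements _) placed-total

    C≤T : C ≤ T
    C≤T = ≤-trans (∑-mono-≤ ⌈n/2⌉≤legPlaced) legPlacements≤T

    centre⇒1+C≤T : Sourced centre → suc C ≤ T
    centre⇒1+C≤T src = ≤-trans (+-mono-≤ (sourced⇒placed src) (∑-mono-≤ ⌈n/2⌉≤legPlaced)) placed-total

    surplus⇒1+C≤T : ∀ {a} → Surplus a → suc C ≤ T
    surplus⇒1+C≤T {a} surplus = ≤-trans (∑-mono-< a ⌈n/2⌉≤legPlaced surplus) legPlacements≤T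

    centre-surplus⇒2+C≤T : ∀ {a} → Sourced centre → Surplus a → 2 + C ≤ T
    centre-surplus⇒2+C≤T {a} src surplus =
      ≤-trans (+-mono-≤ (sourced⇒placed src) (∑-mono-< a ⌈n/2⌉≤legPlaced surplus)) placed-total

    surpluses⇒2+C≤T : ∀ {a b} → a ≢ b → Surplus a → Surplus b → 2 + C ≤ T
    surpluses⇒2+C≤T a≢b surplus-a surplus-b =
      ≤-trans (∑-mono-<₂ a≢b ⌈n/2⌉≤legPlaced surplus-a surplus-b) legPlacements≤T

  module AtT = Horizon t (λ v _ → firstBlue≤t v)

  module BeforeT (late : NoSourceInLastRound) =
    Horizon (pred t) (λ v src → suc[m]≤n⇒m≤pred[n] (late v src))

  ≤pred[t]⇒<t : ∀ {k} → k ≤ pred t → suc k ≤ t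
  ≤pred[t]⇒<t = m≤pred[n]⇒suc[m]≤n {{>-nonZero (≤-trans (1≤firstBlue centre) (firstBlue≤t centre))}}

  C≤t : C ≤ t
  C≤t = AtT.C≤T

  no-odd-legs⇒2+C≤t : K ≡ 0 → 0 < r → 2 + C ≤ t
  no-odd-legs⇒2+C≤t K≡0 0<r = by-centre (sourced-or-propagated centre)
    where
    even : ∀ i → n i % 2 ≡ 0
    even i = n≤0⇒n≡0 (subst (n i % 2 ≤_) K≡0 (entry≤∑ (λ i → n i % 2) i))

    by-centre : Sourced centre ⊎ Propagated centre → 2 + C ≤ t
    by-centre (inj₂ prop) =
      let a , b , a≢b , feeder-a , feeder-b = centre-feeders prop
      in AtT.surpluses⇒2+C≤T a≢b (AtT.head-surplus (even a) (feeder-head feeder-a))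
                               (AtT.head-surplus (even b) (feeder-head feeder-b))
    by-centre (inj₁ src) with last-round
    ... | inj₂ late                  = ≤pred[t]⇒<t (BeforeT.centre⇒1+C≤T late src)
    ... | inj₁ (centre , _ , e)      =
      AtT.centre-surplus⇒2+C≤T src (AtT.head-surplus (even (fromℕ< 0<r)) (head-at-last-round e (fromℕ< 0<r)))
    ... | inj₁ (leg c j , src-x , e) =
      AtT.centre-surplus⇒2+C≤T src (AtT.pair-surplus (even c)
        (pair-at-last-round src-x e (even⇒2≤ (even c) (legs-nonempty c))))

  feeder-leg-surplus : ∀ {a j} → Feeder a → Sourced (leg a j) → firstBlue (leg a j) ≡ t → AtT.Surplus a
  feeder-leg-surplus {j = j} feeder src e =
    AtT.head-pair-surplus (feeder-head feeder) (pair-at-last-round src e (distinct⇒2≤ not-feeder))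
    where
    not-feeder : j ≢ Feeder.position feeder
    not-feeder refl = <⇒≢ (<-≤-trans (Feeder.earlier feeder) (firstBlue≤t centre)) e

  at-most-two-odd-legs⇒1+C≤t : K ≤ 2 → suc C ≤ t
  at-most-two-odd-legs⇒1+C≤t K≤2 with sourced-or-propagated centre
  ... | inj₁ src  = AtT.centre⇒1+C≤T src
  ... | inj₂ prop with centre-feeders prop
  ...   | a , b , a≢b , feeder-a , feeder-b with n%2≡0⊎n%2≡1 (n a) | n%2≡0⊎n%2≡1 (n b)
  ...     | inj₁ even-a | _           = AtT.surplus⇒1+C≤T (AtT.head-surplus even-a (feeder-head feeder-a))
  ...     | inj₂ _      | inj₁ even-b = AtT.surplus⇒1+C≤T (AtT.head-surplus even-b (feeder-head feeder-b))
  ...     | inj₂ odd-a  | inj₂ odd-b  = by-last-round last-round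
    where
    other-leg-even : ∀ c → a ≢ c → b ≢ c → n c % 2 ≡ 0
    other-leg-even c a≢c b≢c with n%2≡0⊎n%2≡1 (n c)
    ... | inj₁ even-c = even-c
    ... | inj₂ odd-c  = contradiction
      (≤-trans (≤-reflexive (cong₂ _+_ (cong₂ _+_ (sym odd-a) (sym odd-b)) (sym odd-c)))
               (≤-trans (entries₃≤∑ (λ i → n i % 2) a≢b a≢c b≢c) K≤2))
      λ { (s≤s (s≤s ())) }

    by-last-round : SourcedInLastRound ⊎ NoSourceInLastRound → suc C ≤ t
    by-last-round (inj₂ late)                  = ≤pred[t]⇒<t (BeforeT.C≤T late)
    by-last-round (inj₁ (centre , src , _))    = AtT.centre⇒1+C≤T src
    by-last-round (inj₁ (leg c j , src , e)) with a Fin.≟ c | b Fin.≟ c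
    ... | yes refl | _        = AtT.surplus⇒1+C≤T (feeder-leg-surplus feeder-a src e)
    ... | no _     | yes refl = AtT.surplus⇒1+C≤T (feeder-leg-surplus feeder-b src e)
    ... | no a≢c   | no b≢c   =
      let even-c = other-leg-even c a≢c b≢c
      in AtT.surplus⇒1+C≤T (AtT.pair-surplus even-c (pair-at-last-round src e (even⇒2≤ even-c (legs-nonempty c))))

module Schedule {r : ℕ} (ns : Vec ℕ r) (legs-nonempty : ∀ i → 1 ≤ lookup ns i)
                (initial : List (SpiderV ns)) (anchored : Fin r → Bool) where
  open SpiderGraph ns
  open Burning (Spider ns)

  lastPosition : ∀ i → Fin (n i)
  lastPosition i = fromℕ< (≤-reflexive (suc-pred (n i) {{>-nonZero (legs-nonempty i)}}))

  suc-lastPosition : ∀ i → suc (toℕ (lastPosition i)) ≡ n i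
  suc-lastPosition i = trans (cong suc (toℕ-fromℕ< _)) (suc-pred (n i) {{>-nonZero (legs-nonempty i)}})

  interior : (i : Fin r) → List (Fin (n i))
  interior i = if anchored i then positiveEvenPositions (n i) else oddPositions (n i)

  tip : Fin r → List (SpiderV ns)
  tip i = if anchored i then [] else replicate (n i % 2) (leg i (lastPosition i))

  interiorVertices : Fin r → List (SpiderV ns)
  interiorVertices i = map (leg i) (interior i)

  middle : List (SpiderV ns)
  middle = concatᵛ interiorVertices

  tips : List (SpiderV ns)
  tips = concatᵛ tip

  -- The leaves of odd unanchored legs come last: no other vertex waits for them.
  schedule : List (SpiderV ns)
  schedule = (initial ++ middle) ++ tips

  length-middle : length middle ≤ ∑[ i < r ] ⌊ n i /2⌋
  length-middle = ≤-trans (≤-reflexive (length-concatᵛ interiorVertices)) (∑-mono-≤ λ i →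
    ≤-trans (≤-reflexive (length-map (leg {ns = ns} i) (interior i))) (length-interior i))
    where
    length-interior : ∀ i → length (interior i) ≤ ⌊ n i /2⌋
    length-interior i with anchored i
    ... | true  = length-positiveEvenPositions (n i)
    ... | false = length-oddPositions (n i)

  length-tip : ∀ i → length (tip i) ≤ n i % 2
  length-tip i with anchored i
  ... | false = ≤-reflexive (length-replicate (n i % 2))
  ... | true  = z≤n

  length-tips : length tips ≡ ∑[ i < r ] length (tip i)
  length-tips = length-concatᵛ tip

  length-tips≤K : length tips ≤ K
  length-tips≤K = ≤-trans (≤-reflexive length-tips) (∑-mono-≤ length-tip)

  length-tip-anchored : ∀ i → anchored i ≡ true → length (tip i) ≡ 0
  length-tip-anchored i a with anchored i
  ... | true = refl

  free-odd∈middle : ∀ {i j} → anchored i ≡ false → toℕ j % 2 ≡ 1 → leg i j ∈ middle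
  free-odd∈middle {i} {j} free odd = ∈-concatᵛ interiorVertices i (∈-map⁺ (leg i) (∈-interior free))
    where
    ∈-interior : anchored i ≡ false → j ∈ interior i
    ∈-interior free rewrite free = ∈-oddPositions j odd

  anchored-even∈middle : ∀ {i j} → anchored i ≡ true → toℕ j % 2 ≡ 0 → toℕ j ≢ 0 → leg i j ∈ middle
  anchored-even∈middle {i} {j} anch even j≢0 = ∈-concatᵛ interiorVertices i (∈-map⁺ (leg i) (∈-interior anch))
    where
    ∈-interior : anchored i ≡ true → j ∈ interior i
    ∈-interior anch rewrite anch = ∈-positiveEvenPositions j even j≢0

  last∈tips : ∀ {i} → anchored i ≡ false → n i % 2 ≡ 1 → leg i (lastPosition i) ∈ tips
  last∈tips {i} free odd = ∈-concatᵛ tip i ∈-tip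
    where
    ∈-tip : leg i (lastPosition i) ∈ tip i
    ∈-tip rewrite free | odd = here refl

  module Timing (T : ℕ) (early : length (initial ++ middle) ≤ T) (total : length schedule ≤ suc T)
                (centre-blue : Blue (Spider ns) schedule (suc (length initial)) centre)
                (anchors : ∀ {i j} → anchored i ≡ true → toℕ j ≡ 0 → leg i j ∈ initial)
                (anchored-odd : ∀ {i} → anchored i ≡ true → n i % 2 ≡ 1) where

    early-blue : ∀ {v} → v ∈ initial ++ middle → Blue (Spider ns) schedule T v
    early-blue v∈ = prefix-blue (initial ++ middle) tips v∈ early

    middle-blue : ∀ {v} → v ∈ middle → Blue (Spider ns) schedule T v
    middle-blue = early-blue ∘ ∈-++⁺ʳ initial

    centre-blue-early : ∀ {v} → v ∈ middle → Blue (Spider ns) schedule T centre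
    centre-blue-early {v} v∈middle = blue-mono (≤-trans initial<early early) centre-blue
      where
      1≤length : ∀ {xs : List (SpiderV ns)} → v ∈ xs → 1 ≤ length xs
      1≤length (here _)  = s≤s z≤n
      1≤length (there _) = s≤s z≤n

      initial<early : suc (length initial) ≤ length (initial ++ middle)
      initial<early = begin
        suc (length initial)            ≡⟨ +-comm 1 _ ⟩
        length initial + 1              ≤⟨ +-monoʳ-≤ (length initial) (1≤length v∈middle) ⟩
        length initial + length middle  ≡⟨ length-++ initial ⟨
        length (initial ++ middle)      ∎
        where open ≤-Reasoning

    spread-inner : ∀ {i j k k′} → suc (toℕ k) ≡ toℕ j → suc (toℕ j) ≡ toℕ k′ →
                   Blue (Spider ns) schedule T (leg i k) → Blue (Spider ns) schedule T (leg i k′) →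
                   Blue (Spider ns) schedule (suc T) (leg i j)
    spread-inner {i} {j} {k} {k′} k↑j j↑k′ = spread k≢k′ (dn (sym k↑j)) (up j↑k′)
      where
      k≢k′ : leg i k ≢ leg i k′
      k≢k′ refl = <-irrefl (sym (trans (cong suc k↑j) j↑k′)) (m<n⇒m<1+n (n<1+n _))

    spread-first : ∀ {i j k′} → toℕ j ≡ 0 → suc (toℕ j) ≡ toℕ k′ →
                   Blue (Spider ns) schedule T centre → Blue (Spider ns) schedule T (leg i k′) →
                   Blue (Spider ns) schedule (suc T) (leg i j)
    spread-first j≡0 j↑k′ = spread (λ ()) (l-c j≡0) (up j↑k′)

    anchored-even-blue : ∀ {i j} → anchored i ≡ true → toℕ j % 2 ≡ 0 → Blue (Spider ns) schedule T (leg i j)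
    anchored-even-blue {i} {j} anch even with toℕ j ≟ 0
    ... | yes j≡0 = early-blue (∈-++⁺ˡ (anchors anch j≡0))
    ... | no  j≢0 = middle-blue (anchored-even∈middle anch even j≢0)

    anchored-odd-blue : ∀ {i j} → anchored i ≡ true → toℕ j % 2 ≡ 1 → Blue (Spider ns) schedule (suc T) (leg i j)
    anchored-odd-blue {i} {j} anch odd =
      let k  , k↑j  = below j≢0
          k′ , j↑k′ = above not-last
      in spread-inner k↑j j↑k′ (anchored-even-blue anch (next-odd⇒even k↑j odd))
                               (anchored-even-blue anch (odd⇒next-even j↑k′ odd))
      where
      j≢0 : toℕ j ≢ 0
      j≢0 j≡0 = contradiction (trans (sym (cong (_% 2) j≡0)) odd) 0≢1+n
      not-last : suc (toℕ j) ≢ n i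
      not-last last = contradiction (trans (sym (odd⇒next-even last odd)) (anchored-odd anch)) 0≢1+n

    free-even-blue : ∀ {i j} → anchored i ≡ false → toℕ j % 2 ≡ 0 → Blue (Spider ns) schedule (suc T) (leg i j)
    free-even-blue {i} {j} free even with suc (toℕ j) ≟ n i
    ... | yes last = subst (λ xs → Blue (Spider ns) xs (suc T) (leg i j)) (++-identityʳ schedule)
                       (prefix-blue schedule [] (∈-++⁺ʳ (initial ++ middle) tip∈tips) total)
      where
      tip∈tips : leg i j ∈ tips
      tip∈tips = subst (λ k → leg i k ∈ tips) (toℕ-injective (suc-injective (trans (suc-lastPosition i) (sym last))))
                       (last∈tips free (even⇒next-odd last even))
    ... | no not-last with above not-last | toℕ j ≟ 0
    ...   | k′ , j↑k′ | yes j≡0 =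
      let next∈middle = free-odd∈middle free (even⇒next-odd j↑k′ even)
      in spread-first j≡0 j↑k′ (centre-blue-early next∈middle) (middle-blue next∈middle)
    ...   | k′ , j↑k′ | no j≢0  =
      let k , k↑j = below j≢0
      in spread-inner k↑j j↑k′ (middle-blue (free-odd∈middle free (next-even⇒odd k↑j even)))
                               (middle-blue (free-odd∈middle free (even⇒next-odd j↑k′ even)))

    all-blue : AllBlue (Spider ns) schedule (suc T)
    all-blue centre    = blue-mono (s≤s (≤-trans (length-++-≤ˡ initial) early)) centre-blue
    all-blue (leg i j) with anchored i in anch | n%2≡0⊎n%2≡1 (toℕ j)
    ... | false | inj₂ odd  = blue-mono (n≤1+n T) (middle-blue (free-odd∈middle anch odd))
    ... | false | inj₁ even = free-even-blue anch even
    ... | true  | inj₁ even = blue-mono (n≤1+n T) (anchored-even-blue anch even)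
    ... | true  | inj₂ odd  = anchored-odd-blue anch odd

module SpiderB₂ {r : ℕ} (ns : Vec ℕ r) (legs-nonempty : ∀ i → 1 ≤ lookup ns i) where
  open SpiderGraph ns
  open Burning (Spider ns)

  F : ℕ
  F = ∑[ i < r ] ⌊ n i /2⌋

  C≡F+K : C ≡ F + K
  C≡F+K = trans (sum-cong-≗ λ i → ⌈n/2⌉≡⌊n/2⌋+n%2 (n i))
                (∑-distrib-+ (λ i → ⌊ n i /2⌋) (λ i → n i % 2))

  sum+K≡C+C : sum ns + K ≡ C + C
  sum+K≡C+C = begin
    sum ns + K                                   ≡⟨ cong (_+ K) (sum≡∑lookup ns) ⟩
    ∑ n + K                                      ≡⟨ ∑-distrib-+ n (λ i → n i % 2) ⟨
    ∑[ i < r ] (n i + n i % 2)                   ≡⟨ sum-cong-≗ (λ i → ⌈n/2⌉+⌈n/2⌉≡n+n%2 (n i)) ⟨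
    ∑[ i < r ] (⌈ n i /2⌉ + ⌈ n i /2⌉)           ≡⟨ ∑-distrib-+ (λ i → ⌈ n i /2⌉) (λ i → ⌈ n i /2⌉) ⟩
    C + C                                        ∎
    where open ≡-Reasoning

  few-odd-schedule : ∀ T → suc F ≤ T → F + K ≤ T → Σ (List (SpiderV ns)) λ s → AllBlue (Spider ns) s (suc T)
  few-odd-schedule T F<T F+K≤T = schedule , all-blue
    where
    open Schedule ns legs-nonempty (centre ∷ []) (λ _ → false)

    total : length schedule ≤ suc T
    total = begin
      length schedule                       ≡⟨ length-++ (centre ∷ middle) ⟩
      suc (length middle + length tips)     ≤⟨ s≤s (+-mono-≤ length-middle length-tips≤K) ⟩
      suc (F + K)                           ≤⟨ s≤s F+K≤T ⟩
      suc T                                 ∎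
      where open ≤-Reasoning

    open Timing T (≤-trans (s≤s length-middle) F<T) total (inj₁ (inj₂ (inj₁ refl))) (λ ()) (λ ())

  module ManyOdd {a b : Fin r} (a≢b : a ≢ b) (odd-a : n a % 2 ≡ 1) (odd-b : n b % 2 ≡ 1) (3≤K : 3 ≤ K) where

    anchored : Fin r → Bool
    anchored i = does (i Fin.≟ a) Bool.∨ does (i Fin.≟ b)

    anchored⇒ : ∀ {i} → anchored i ≡ true → i ≡ a ⊎ i ≡ b
    anchored⇒ {i} anch with i Fin.≟ a | i Fin.≟ b
    ... | yes i≡a | _       = inj₁ i≡a
    ... | no _    | yes i≡b = inj₂ i≡b

    anchored-a : anchored a ≡ true
    anchored-a = cong (Bool._∨ does (a Fin.≟ b)) (dec-true (a Fin.≟ a) refl)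

    anchored-b : anchored b ≡ true
    anchored-b = trans (cong (does (b Fin.≟ a) Bool.∨_) (dec-true (b Fin.≟ b) refl)) (∨-zeroʳ _)

    first : ∀ i → Fin (n i)
    first i = fromℕ< (legs-nonempty i)

    heads : List (SpiderV ns)
    heads = leg a (first a) ∷ leg b (first b) ∷ []

    open Schedule ns legs-nonempty heads anchored

    2+tips≤K : 2 + length tips ≤ K
    2+tips≤K = ≤-trans (≤-reflexive (cong (2 +_) length-tips))
                       (∑-mono-<₂ a≢b length-tip (tip-below anchored-a odd-a) (tip-below anchored-b odd-b))
      where
      tip-below : ∀ {i} → anchored i ≡ true → n i % 2 ≡ 1 → length (tip i) < n i % 2
      tip-below {i} anch odd = ≤-trans (≤-reflexive (cong suc (length-tip-anchored i anch))) (≤-reflexive (sym odd))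

    C-nonZero : NonZero C
    C-nonZero = >-nonZero (≤-trans (s≤s z≤n) (≤-trans 3≤K (≤-trans (m≤n+m K F) (≤-reflexive (sym C≡F+K)))))

    early : length (heads ++ middle) ≤ pred C
    early = suc[m]≤n⇒m≤pred[n] (begin
      3 + length middle     ≡⟨ +-comm 3 _ ⟩
      length middle + 3     ≤⟨ +-mono-≤ length-middle 3≤K ⟩
      F + K                 ≡⟨ C≡F+K ⟨
      C                     ∎)
      where open ≤-Reasoning

    total : length schedule ≤ suc (pred C)
    total = begin
      length schedule                           ≡⟨ length-++ (heads ++ middle) ⟩
      2 + length middle + length tips           ≡⟨ trans (+-suc (length middle) _) (cong suc (+-suc (length middle) _)) ⟨
      length middle + (2 + length tips)         ≤⟨ +-mono-≤ length-middle 2+tips≤K ⟩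
      F + K                                     ≡⟨ C≡F+K ⟨
      C                                         ≡⟨ suc-pred C {{C-nonZero}} ⟨
      suc (pred C)                              ∎
      where open ≤-Reasoning

    centre-blue : Blue (Spider ns) schedule 3 centre
    centre-blue = spread {s = schedule} (λ e → a≢b (cong legIndex e))
                         (c-l {j = first a} (toℕ-fromℕ< _)) (c-l {j = first b} (toℕ-fromℕ< _))
                         (inj₁ (inj₂ (inj₁ refl))) (inj₂ (inj₁ refl))
      where
      legIndex : SpiderV ns → Fin r
      legIndex centre    = a
      legIndex (leg i _) = i

    anchors : ∀ {i j} → anchored i ≡ true → toℕ j ≡ 0 → leg i j ∈ heads
    anchors {i} {j} anch j≡0 with anchored⇒ {i} anch
    ... | inj₁ refl = here (cong (leg a) (toℕ-injective (trans j≡0 (sym (toℕ-fromℕ< _)))))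
    ... | inj₂ refl = there (here (cong (leg b) (toℕ-injective (trans j≡0 (sym (toℕ-fromℕ< _))))))

    anchored-odd : ∀ {i} → anchored i ≡ true → n i % 2 ≡ 1
    anchored-odd {i} anch with anchored⇒ {i} anch
    ... | inj₁ refl = odd-a
    ... | inj₂ refl = odd-b

    open Timing (pred C) early total centre-blue anchors anchored-odd

    many-odd-schedule : Σ (List (SpiderV ns)) λ s → AllBlue (Spider ns) s C
    many-odd-schedule = schedule , subst (AllBlue (Spider ns) schedule) (suc-pred C {{C-nonZero}}) all-blue

  b₂-no-odd : K ≡ 0 → 0 < r → IsB2 (Spider ns) (2 + C)
  b₂-no-odd K≡0 0<r =
    few-odd-schedule (suc C) (s≤s F≤C) (≤-trans (≤-reflexive (sym C≡F+K)) (n≤1+n C)) ,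
    λ s t all-blue → LowerBound.no-odd-legs⇒2+C≤t ns legs-nonempty s t all-blue K≡0 0<r
    where
    F≤C : F ≤ C
    F≤C = ≤-trans (m≤m+n F K) (≤-reflexive (sym C≡F+K))

  b₂-few-odd : 1 ≤ K → K ≤ 2 → IsB2 (Spider ns) (suc C)
  b₂-few-odd 1≤K K≤2 =
    few-odd-schedule C 1+F≤C (≤-reflexive (sym C≡F+K)) ,
    λ s t all-blue → LowerBound.at-most-two-odd-legs⇒1+C≤t ns legs-nonempty s t all-blue K≤2
    where
    1+F≤C : suc F ≤ C
    1+F≤C = begin
      suc F    ≡⟨ +-comm 1 F ⟩
      F + 1    ≤⟨ +-monoʳ-≤ F 1≤K ⟩
      F + K    ≡⟨ C≡F+K ⟨
      C        ∎
      where open ≤-Reasoning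

  b₂-many-odd : 3 ≤ K → IsB2 (Spider ns) C
  b₂-many-odd 3≤K =
    let a , b , a≢b , 1≤pa , 1≤pb = two-positive-entries (λ i → n i % 2) (λ i → n%2≤1 (n i))
                                                         (≤-trans (n≤1+n 2) 3≤K)
    in ManyOdd.many-odd-schedule a≢b (≤-antisym (n%2≤1 (n a)) 1≤pa) (≤-antisym (n%2≤1 (n b)) 1≤pb) 3≤K ,
       λ s t all-blue → LowerBound.C≤t ns legs-nonempty s t all-blue

no-odd-target : ∀ {S c} → S + 0 ≡ c + c → ⌈ S + 1 /2⌉ + 1 ≡ 2 + c
no-odd-target {S} {c} S+0≡c+c with trans (sym (+-identityʳ S)) S+0≡c+c
... | refl = begin
  ⌈ c + c + 1 /2⌉ + 1   ≡⟨ cong (λ m → ⌈ m /2⌉ + 1) (+-comm (c + c) 1) ⟩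
  suc ⌊ c + c /2⌋ + 1   ≡⟨ cong (λ m → suc m + 1) (n≡⌊n+n/2⌋ c) ⟨
  suc c + 1             ≡⟨ +-comm (suc c) 1 ⟩
  2 + c                 ∎
  where open ≡-Reasoning

few-odd-target : ∀ {S k c} → S + k ≡ c + c → 1 ≤ k → k ≤ 2 → ⌈ S + 1 /2⌉ + 1 ≡ suc c
few-odd-target {S} {1} {c} S+1≡c+c _ _ = begin
  ⌈ S + 1 /2⌉ + 1       ≡⟨ cong (λ m → ⌈ m /2⌉ + 1) S+1≡c+c ⟩
  ⌈ c + c /2⌉ + 1       ≡⟨ cong (_+ 1) (n≡⌈n+n/2⌉ c) ⟨
  c + 1                 ≡⟨ +-comm c 1 ⟩
  suc c                 ∎
  where open ≡-Reasoning
few-odd-target {S} {2} {c} S+2≡c+c _ _ = begin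
  ⌈ S + 1 /2⌉ + 1       ≡⟨ cong (λ m → ⌊ m /2⌋ + 1) (+-suc S 1) ⟨
  ⌊ S + 2 /2⌋ + 1       ≡⟨ cong (λ m → ⌊ m /2⌋ + 1) S+2≡c+c ⟩
  ⌊ c + c /2⌋ + 1       ≡⟨ cong (_+ 1) (n≡⌊n+n/2⌋ c) ⟨
  c + 1                 ≡⟨ +-comm c 1 ⟩
  suc c                 ∎
  where open ≡-Reasoning
few-odd-target {k = suc (suc (suc _))} _ _ (s≤s (s≤s ()))

many-odd-target : ∀ {S k c} → S + k ≡ c + c → ⌊ S + 1 + k ∸ 1 /2⌋ ≡ c
many-odd-target {S} {k} {c} S+k≡c+c = begin
  ⌊ S + 1 + k ∸ 1 /2⌋   ≡⟨ cong (λ m → ⌊ m ∸ 1 /2⌋) (trans (+-assoc S 1 k) (+-suc S k)) ⟩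
  ⌊ S + k /2⌋           ≡⟨ cong ⌊_/2⌋ S+k≡c+c ⟩
  ⌊ c + c /2⌋           ≡⟨ n≡⌊n+n/2⌋ c ⟨
  c                     ∎
  where open ≡-Reasoning

theorem2 : (r : ℕ) → 3 ≤ r → (ns : Vec ℕ r) → ((i : Fin r) → 1 ≤ lookup ns i) →
    (oddCount ns ≤ 2 → IsB2 (Spider ns) (⌈ (sum ns + 1) /2⌉ + 1))
    × (3 ≤ oddCount ns → IsB2 (Spider ns) ⌊ (sum ns + 1 + oddCount ns ∸ 1) /2⌋)
theorem2 r 3≤r ns legs-nonempty = few-odd , many-odd
  where
  open SpiderGraph ns using (C; K)
  open SpiderB₂ ns legs-nonempty

  sum+k≡C+C : sum ns + oddCount ns ≡ C + C
  sum+k≡C+C = trans (cong (sum ns +_) (oddCount≡∑ ns)) sum+K≡C+C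

  few-odd : oddCount ns ≤ 2 → IsB2 (Spider ns) (⌈ (sum ns + 1) /2⌉ + 1)
  few-odd k≤2 with K ≟ 0 | subst (_≤ 2) (oddCount≡∑ ns) k≤2
  ... | yes K≡0 | _   = subst (IsB2 (Spider ns)) (sym (no-odd-target (subst (λ k → sum ns + k ≡ C + C) K≡0 sum+K≡C+C)))
                          (b₂-no-odd K≡0 (≤-trans (s≤s z≤n) 3≤r))
  ... | no K≢0  | K≤2 = subst (IsB2 (Spider ns)) (sym (few-odd-target {sum ns} sum+K≡C+C (n≢0⇒n>0 K≢0) K≤2))
                          (b₂-few-odd (n≢0⇒n>0 K≢0) K≤2)

  many-odd : 3 ≤ oddCount ns → IsB2 (Spider ns) ⌊ (sum ns + 1 + oddCount ns ∸ 1) /2⌋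
  many-odd 3≤k = subst (IsB2 (Spider ns)) (sym (many-odd-target {sum ns} {oddCount ns} sum+k≡C+C))
                       (b₂-many-odd (subst (3 ≤_) (oddCount≡∑ ns) 3≤k))
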